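{- Let $X$ be a finite connected directed graph, and let $(X_n)_{n\ge0}$ and $(X'_n)_{n\ge0}$ be two constant $\mathbb{Z}_p$-towers (of connected graphs) over $X$, possibly arising from different constant voltage assignments. Then $X_n$ and $X'_n$ are isomorphic directed graphs for all $n\ge0$.
   Context: Directed graphs may have multiple edges and loops; connected means the underlying undirected graph is connected. For $\alpha:\mathbb{E}(X)\to\mathbb{Z}/p^n\mathbb{Z}$ the derived graph $X(\mathbb{Z}/p^n\mathbb{Z},\alpha)$ has vertex set $\mathbb{V}(X)\times\mathbb{Z}/p^n\mathbb{Z}$ and edge set $\mathbb{E}(X)\times\mathbb{Z}/p^n\mathbb{Z}$, where if $e$ goes from $s$ to $t$ then $(e,\sigma)$ goes from $(s,\sigma)$ to $(t,\sigma+\alpha(e))$. For $\alpha:\mathbb{E}(X)\to\mathbb{Z}_p$, $\alpha_{/n}$ is its reduction modulo $p^n$. A $\mathbb{Z}_p$-tower over $X$ is a sequence of coverings $X=X_0\leftarrow X_1\leftarrow\cdots$ such that each $X_n\to X$ is Galois (each vertex of $X$ has exactly $d$ preimages and the group of deck transformations has order $d$) with deck group isomorphic to $\mathbb{Z}/p^n\mathbb{Z}$. A constant $\mathbb{Z}_p$-tower over $X$ is a $\mathbb{Z}_p$-tower with $X_n=X(\mathbb{Z}/p^n\mathbb{Z},\alpha_{/n})$ for some voltage assignment $\alpha:\mathbb{E}(X)\to\mathbb{Z}_p$ taking the same value on all edges. -}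

module Defs where

open import Data.Nat using (ℕ; zero; suc; _+_; _*_; _^_; NonZero; nonTrivial⇒nonZero)
open import Data.Nat.DivMod using (_mod_)
open import Data.Nat.Properties using (m^n≢0)
open import Data.Nat.Primality using (Prime; prime)
open import Data.Fin using (Fin; toℕ)
open import Data.Product using (_×_; _,_; ∃)
open import Relation.Binary.PropositionalEquality using (_≡_)

record Digraph : Set₁ where
  field
    V   : Set
    E   : Set
    src : E → V
    tgt : E → V
open Digraph public

record FinDigraph (v e : ℕ) : Set where
  field
    s : Fin e → Fin v
    t : Fin e → Fin v
open FinDigraph public

toDigraph : ∀ {v e} → FinDigraph v e → Digraph
toDigraph {v} {e} X = record { V = Fin v ; E = Fin e ; src = s X ; tgt = t X }

-- Connectivity of the underlying undirected graph: any two vertices are joined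
-- by a walk which may traverse edges in either direction.
data Walk (G : Digraph) : V G → V G → Set where
  here : ∀ {x} → Walk G x x
  fwd  : ∀ {y} (ε : E G) → Walk G (tgt G ε) y → Walk G (src G ε) y
  bwd  : ∀ {y} (ε : E G) → Walk G (src G ε) y → Walk G (tgt G ε) y

Connected : Digraph → Set
Connected G = ∀ (x y : V G) → Walk G x y

record _≅_ (G H : Digraph) : Set where
  field
    fV  : V G → V H
    gV  : V H → V G
    fE  : E G → E H
    gE  : E H → E G
    gfV : ∀ x → gV (fV x) ≡ x
    fgV : ∀ y → fV (gV y) ≡ y
    gfE : ∀ x → gE (fE x) ≡ x
    fgE : ∀ y → fE (gE y) ≡ y
    src-comm : ∀ ε → src H (fE ε) ≡ fV (src G ε)
    tgt-comm : ∀ ε → tgt H (fE ε) ≡ fV (tgt G ε)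

-- p-adic integers ℤ_p as the inverse limit of ℤ/p^nℤ: compatible sequences
-- of residues x n ∈ {0,…,p^n-1} with x (n+1) ≡ x n (mod p^n).
record ℤ[_] (p : ℕ) : Set where
  field
    res    : (n : ℕ) → Fin (p ^ n)
    compat : ∀ n → ∃ λ k → toℕ (res (suc n)) ≡ toℕ (res n) + k * p ^ n
open ℤ[_] public

_/[_] : ∀ {p} → ℤ[ p ] → (n : ℕ) → Fin (p ^ n)
a /[ n ] = res a n

prime⇒nonZero : ∀ {p} → Prime p → NonZero p
prime⇒nonZero {zero} (prime {{()}} _)
prime⇒nonZero {suc p} _ = _

derived : ∀ {v e} (X : FinDigraph v e) (p : ℕ) → Prime p →
          (Fin e → ℤ[ p ]) → (n : ℕ) → Digraph
derived {v} {e} X p pr α n = record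
  { V   = Fin v × Fin (p ^ n)
  ; E   = Fin e × Fin (p ^ n)
  ; src = λ { (ε , σ) → s X ε , σ }
  ; tgt = λ { (ε , σ) → t X ε , add σ ((α ε) /[ n ]) }
  }
  where
  instance
    nzp : NonZero p
    nzp = prime⇒nonZero pr
    nzpn : NonZero (p ^ n)
    nzpn = m^n≢0 p n
  add : Fin (p ^ n) → Fin (p ^ n) → Fin (p ^ n)
  add x y = (toℕ x + toℕ y) mod (p ^ n)

const-volt : ∀ {e p} → ℤ[ p ] → Fin e → ℤ[ p ]
const-volt a _ = a

-- For a constant voltage c, the level σ of a vertex (x , σ) of X_n changes by
-- exactly ±c along each edge, so a walk between two vertices on the same fibre
-- shows that c is a unit modulo p^n whenever X_n is connected. For two units
-- c and c', multiplication of the level by c'·c⁻¹ is then a graph isomorphism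
-- X(ℤ/p^nℤ, c) ≅ X(ℤ/p^nℤ, c') which is the identity on the X-coordinate.
module Submission where

open import Defs
open import Data.Nat using (ℕ; zero; suc; _+_; _*_; _^_; _%_; pred; NonZero)
open import Data.Nat.Properties
  using (m^n≢0; +-identityʳ; +-assoc; *-assoc; *-identityˡ; *-identityʳ; *-distribˡ-+; *-comm; suc-pred)
open import Data.Nat.DivMod
  using (_mod_; %-distribˡ-+; %-distribˡ-*; m%n%n≡m%n; m*n%n≡0; m<n⇒m%n≡m; m%n<n)
open import Data.Nat.Primality using (Prime)
open import Data.Nat.Tactic.RingSolver using (solve-∀)
open import Data.Fin using (Fin; zero; toℕ)
open import Data.Fin.Properties using (toℕ-injective; toℕ<n; toℕ-fromℕ<)
open import Data.Product using (_×_; _,_; ∃; proj₂; map₂)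
open import Data.Empty using (⊥-elim)
open import Level using (0ℓ)
open import Relation.Nullary using (¬_)
open import Relation.Binary using (Rel; Setoid)
import Relation.Binary.Construct.On as On
import Relation.Binary.Reasoning.Setoid
open import Relation.Binary.PropositionalEquality
  using (_≡_; refl; sym; trans; cong; cong₂; setoid; module ≡-Reasoning)

vertexless-≅ : ∀ {G H} → ¬ V G → ¬ V H → G ≅ H
vertexless-≅ {G} {H} ¬G ¬H = record
  { fV = λ x → ⊥-elim (¬G x) ; gV = λ y → ⊥-elim (¬H y)
  ; fE = λ ε → ⊥-elim (¬G (src G ε)) ; gE = λ ε → ⊥-elim (¬H (src H ε))
  ; gfV = λ x → ⊥-elim (¬G x) ; fgV = λ y → ⊥-elim (¬H y)
  ; gfE = λ ε → ⊥-elim (¬G (src G ε)) ; fgE = λ ε → ⊥-elim (¬H (src H ε))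
  ; src-comm = λ ε → ⊥-elim (¬G (src G ε)) ; tgt-comm = λ ε → ⊥-elim (¬G (src G ε))
  }

module Congruence (m : ℕ) .{{_ : NonZero m}} where

  infix 4 _≋_
  _≋_ : Rel ℕ 0ℓ
  x ≋ y = x % m ≡ y % m

  ≋-setoid : Setoid 0ℓ 0ℓ
  ≋-setoid = On.setoid (setoid ℕ) (_% m)

  open Setoid ≋-setoid public using () renaming (refl to ≋-refl; sym to ≋-sym)

  +-cong-≋ : ∀ {a b c d} → a ≋ b → c ≋ d → a + c ≋ b + d
  +-cong-≋ {a} {b} {c} {d} a≋b c≋d = begin
    (a + c) % m             ≡⟨ %-distribˡ-+ a c m ⟩
    (a % m + c % m) % m     ≡⟨ cong₂ (λ x y → (x + y) % m) a≋b c≋d ⟩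
    (b % m + d % m) % m     ≡⟨ %-distribˡ-+ b d m ⟨
    (b + d) % m             ∎
    where open ≡-Reasoning

  *-cong-≋ : ∀ {a b c d} → a ≋ b → c ≋ d → a * c ≋ b * d
  *-cong-≋ {a} {b} {c} {d} a≋b c≋d = begin
    (a * c) % m             ≡⟨ %-distribˡ-* a c m ⟩
    (a % m * (c % m)) % m   ≡⟨ cong₂ (λ x y → (x * y) % m) a≋b c≋d ⟩
    (b % m * (d % m)) % m   ≡⟨ %-distribˡ-* b d m ⟨
    (b * d) % m             ∎
    where open ≡-Reasoning

  toℕ-mod-≋ : ∀ x → toℕ (x mod m) ≋ x
  toℕ-mod-≋ x = trans (cong (_% m) (toℕ-fromℕ< (m%n<n x m))) (m%n%n≡m%n x m)

  toℕ-≋⇒≡ : ∀ {σ τ : Fin m} → toℕ σ ≋ toℕ τ → σ ≡ τ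
  toℕ-≋⇒≡ {σ} {τ} σ≋τ =
    toℕ-injective (trans (sym (m<n⇒m%n≡m (toℕ<n σ))) (trans σ≋τ (m<n⇒m%n≡m (toℕ<n τ))))

  +-pred-*-≋-0 : ∀ c → c + pred m * c ≋ 0
  +-pred-*-≋-0 c = trans (cong (λ k → (k * c) % m) (suc-pred m))
                       (trans (cong (_% m) (*-comm m c)) (trans (m*n%n≡0 c m) (sym (m*n%n≡0 0 m))))

  IsUnit : ℕ → Set
  IsUnit c = ∃ λ k → k * c ≋ 1

  scale : ℕ → Fin m → Fin m
  scale u σ = (u * toℕ σ) mod m

  scale-inverse : ∀ u w → w * u ≋ 1 → ∀ σ → scale w (scale u σ) ≡ σ
  scale-inverse u w wu≋1 σ = toℕ-≋⇒≡ (begin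
    toℕ (scale w (scale u σ))   ≈⟨ toℕ-mod-≋ _ ⟩
    w * toℕ (scale u σ)         ≈⟨ *-cong-≋ (≋-refl {w}) (toℕ-mod-≋ (u * toℕ σ)) ⟩
    w * (u * toℕ σ)             ≡⟨ *-assoc w u (toℕ σ) ⟨
    w * u * toℕ σ               ≈⟨ *-cong-≋ wu≋1 ≋-refl ⟩
    1 * toℕ σ                   ≡⟨ *-identityˡ (toℕ σ) ⟩
    toℕ σ                       ∎)
    where open Relation.Binary.Reasoning.Setoid ≋-setoid

  scale-shift : ∀ u c c' → u * c ≋ c' → ∀ σ →
                (toℕ (scale u σ) + c') mod m ≡ scale u ((toℕ σ + c) mod m)
  scale-shift u c c' uc≋c' σ = toℕ-≋⇒≡ (begin
    toℕ ((toℕ (scale u σ) + c') mod m)  ≈⟨ toℕ-mod-≋ _ ⟩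
    toℕ (scale u σ) + c'                ≈⟨ +-cong-≋ (toℕ-mod-≋ _) (≋-sym uc≋c') ⟩
    u * toℕ σ + u * c                   ≡⟨ *-distribˡ-+ u (toℕ σ) c ⟨
    u * (toℕ σ + c)                     ≈⟨ *-cong-≋ (≋-refl {u}) (≋-sym (toℕ-mod-≋ (toℕ σ + c))) ⟩
    u * toℕ ((toℕ σ + c) mod m)         ≈⟨ ≋-sym (toℕ-mod-≋ _) ⟩
    toℕ (scale u ((toℕ σ + c) mod m))   ∎)
    where open Relation.Binary.Reasoning.Setoid ≋-setoid

-- X(ℤ/mℤ, c) for the constant voltage c; derived X p pr (const-volt a) n is
-- definitionally cyclicCover X (p ^ n) (toℕ (a /[ n ])).
cyclicCover : ∀ {v e} → FinDigraph v e → (m : ℕ) .{{_ : NonZero m}} → ℕ → Digraph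
cyclicCover {v} {e} X m c = record
  { V   = Fin v × Fin m
  ; E   = Fin e × Fin m
  ; src = λ { (ε , σ) → s X ε , σ }
  ; tgt = λ { (ε , σ) → t X ε , (toℕ σ + c) mod m }
  }

module _ {v e} (X : FinDigraph v e) (m : ℕ) .{{_ : NonZero m}} where
  open Congruence m

  walk⇒level-shift : ∀ c {x σ y τ} → Walk (cyclicCover X m c) (x , σ) (y , τ) →
                     ∃ λ k → toℕ τ ≋ toℕ σ + k * c
  walk⇒level-shift c {σ = σ} here = 0 , cong (_% m) (sym (+-identityʳ (toℕ σ)))
  walk⇒level-shift c (fwd (ε , σ) w) with walk⇒level-shift c w
  ... | k , τ≋ = suc k , (begin
    _                                 ≈⟨ τ≋ ⟩
    toℕ ((toℕ σ + c) mod m) + k * c   ≈⟨ +-cong-≋ (toℕ-mod-≋ (toℕ σ + c)) ≋-refl ⟩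
    toℕ σ + c + k * c                 ≡⟨ +-assoc (toℕ σ) c (k * c) ⟩
    toℕ σ + suc k * c                 ∎)
    where open Relation.Binary.Reasoning.Setoid ≋-setoid
  -- Without subtraction on ℕ, a backward step adds (m - 1) · c ≋ - c.
  walk⇒level-shift c (bwd (ε , σ) w) with walk⇒level-shift c w
  ... | k , τ≋ = k + pred m , (begin
    _                                         ≈⟨ τ≋ ⟩
    toℕ σ + k * c                             ≡⟨ +-identityʳ _ ⟨
    toℕ σ + k * c + 0                         ≈⟨ +-cong-≋ ≋-refl (≋-sym (+-pred-*-≋-0 c)) ⟩
    toℕ σ + k * c + (c + pred m * c)          ≡⟨ rearrange (toℕ σ) c k (pred m) ⟩
    toℕ σ + c + (k + pred m) * c              ≈⟨ +-cong-≋ (≋-sym (toℕ-mod-≋ (toℕ σ + c))) ≋-refl ⟩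
    toℕ ((toℕ σ + c) mod m) + (k + pred m) * c ∎)
    where
    open Relation.Binary.Reasoning.Setoid ≋-setoid
    rearrange : ∀ s c k q → s + k * c + (c + q * c) ≡ s + c + (k + q) * c
    rearrange = solve-∀

  connected⇒isUnit : ∀ c → Connected (cyclicCover X m c) → Fin v → IsUnit c
  connected⇒isUnit c connected x with walk⇒level-shift c (connected (x , 0 mod m) (x , 1 mod m))
  ... | k , 1≋kc = k , (begin
    k * c                     ≈⟨ +-cong-≋ (≋-sym (toℕ-mod-≋ 0)) ≋-refl ⟩
    toℕ (0 mod m) + k * c     ≈⟨ ≋-sym 1≋kc ⟩
    toℕ (1 mod m)             ≈⟨ toℕ-mod-≋ 1 ⟩
    1                         ∎)
    where open Relation.Binary.Reasoning.Setoid ≋-setoid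

  scale-≅ : ∀ c c' u w → u * w ≋ 1 → u * c ≋ c' → cyclicCover X m c ≅ cyclicCover X m c'
  scale-≅ c c' u w uw≋1 uc≋c' = record
    { fV = map₂ (scale u) ; gV = map₂ (scale w)
    ; fE = map₂ (scale u) ; gE = map₂ (scale w)
    ; gfV = λ { (x , σ) → cong (x ,_) (scale-inverse u w wu≋1 σ) }
    ; fgV = λ { (x , σ) → cong (x ,_) (scale-inverse w u uw≋1 σ) }
    ; gfE = λ { (ε , σ) → cong (ε ,_) (scale-inverse u w wu≋1 σ) }
    ; fgE = λ { (ε , σ) → cong (ε ,_) (scale-inverse w u uw≋1 σ) }
    ; src-comm = λ _ → refl
    ; tgt-comm = λ { (ε , σ) → cong (t X ε ,_) (scale-shift u c c' uc≋c' σ) }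
    }
    where
    wu≋1 : w * u ≋ 1
    wu≋1 = trans (cong (_% m) (*-comm w u)) uw≋1

  units⇒≅ : ∀ c c' → IsUnit c → IsUnit c' → cyclicCover X m c ≅ cyclicCover X m c'
  units⇒≅ c c' (k , kc≋1) (k' , k'c'≋1) = scale-≅ c c' (c' * k) (c * k') uw≋1 uc≋c'
    where
    open Relation.Binary.Reasoning.Setoid ≋-setoid
    uw≋1 : c' * k * (c * k') ≋ 1
    uw≋1 = begin
      c' * k * (c * k')   ≡⟨ regroup c' k c k' ⟩
      k' * c' * (k * c)   ≈⟨ *-cong-≋ k'c'≋1 kc≋1 ⟩
      1 * 1               ∎
      where
      regroup : ∀ c' k c k' → c' * k * (c * k') ≡ k' * c' * (k * c)
      regroup = solve-∀
    uc≋c' : c' * k * c ≋ c'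
    uc≋c' = begin
      c' * k * c          ≡⟨ *-assoc c' k c ⟩
      c' * (k * c)        ≈⟨ *-cong-≋ (≋-refl {c'}) kc≋1 ⟩
      c' * 1              ≡⟨ *-identityʳ c' ⟩
      c'                  ∎

corollary3p7 : ∀ {v e} (X : FinDigraph v e) (p : ℕ) (pr : Prime p) (a a' : ℤ[ p ])
    → Connected (toDigraph X)
    → (∀ n → Connected (derived X p pr (const-volt a) n))
    → (∀ n → Connected (derived X p pr (const-volt a') n))
    → ∀ n → derived X p pr (const-volt a) n ≅ derived X p pr (const-volt a') n
corollary3p7 {zero} X p pr a a' _ _ _ n = vertexless-≅ (λ { (() , _) }) (λ { (() , _) })
corollary3p7 {suc v} X p pr a a' _ connected connected' n =
  units⇒≅ X (p ^ n) (toℕ (a /[ n ])) (toℕ (a' /[ n ])) (unit a connected) (unit a' connected')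
  where
  instance
    _ = prime⇒nonZero pr
    _ = m^n≢0 p n
  unit : ∀ b → (∀ n → Connected (derived X p pr (const-volt b) n)) →
         Congruence.IsUnit (p ^ n) (toℕ (b /[ n ]))
  unit b connectedᵇ = connected⇒isUnit X (p ^ n) (toℕ (b /[ n ])) (connectedᵇ n) zero
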